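{- Let $k\geq 1$ and let $G$ be the cubic graph on $n=6k$ vertices defined as follows: for each $\ell\in\{1,\dots,k\}$ take vertices $a_\ell,b_\ell,c_\ell,d_\ell,e_\ell,f_\ell$ with edges $a_\ell b_\ell, a_\ell c_\ell, b_\ell d_\ell, b_\ell e_\ell, c_\ell d_\ell, c_\ell e_\ell, d_\ell f_\ell, e_\ell f_\ell$, and add the edges $f_\ell a_{\ell+1}$ for $1\le \ell\le k$ (indices modulo $k$, so $f_k a_1$ is an edge). Then $Z(G)=M(G)=n/3+2$.
   Context: For a graph $G$ on vertices $v_1,\dots,v_n$, $S(G)$ is the set of real symmetric $n\times n$ matrices $A$ with $a_{ij}\neq0$ iff $v_iv_j\in E(G)$ for $i\neq j$ (diagonal arbitrary); $M(G)$ is the maximum nullity over $S(G)$. Zero forcing: if a black vertex has exactly one white neighbour, that neighbour becomes black; $Z(G)$ is the minimum size of an initial black set from which repeated application of this rule makes all vertices black. -}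

module Defs where

open import Level using (Level; suc; _⊔_)
open import Data.Nat as ℕ using (ℕ; zero; _≡ᵇ_; _/_; _%_)
open import Data.Bool using (Bool; true; false; _∧_; _∨_; T)
open import Data.Fin as Fin using (Fin; toℕ)
open import Data.Fin.Subset using (Subset; _∈_; ∣_∣)
open import Data.Sum using (_⊎_)
open import Data.Product using (Σ; ∃; _×_; _,_)
open import Relation.Nullary using (¬_)
open import Relation.Binary.PropositionalEquality using (_≡_; _≢_)
open import Function.Bundles using (_⇔_)
open import Algebra.Bundles using (CommutativeRing)

Graph : ℕ → Set₁
Graph n = Fin n → Fin n → Set

data Black {n : ℕ} (G : Graph n) (S : Subset n) : Fin n → Set where
  initial : ∀ {v} → v ∈ S → Black G S v
  force   : ∀ {u v} → G u v → Black G S u →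
            (∀ w → G u w → w ≢ v → Black G S w) → Black G S v

IsZeroForcingSet : ∀ {n} → Graph n → Subset n → Set
IsZeroForcingSet G S = ∀ v → Black G S v

IsZeroForcingNumber : ∀ {n} → Graph n → ℕ → Set
IsZeroForcingNumber {n} G m =
  (Σ (Subset n) λ S → IsZeroForcingSet G S × ∣ S ∣ ≡ m) ×
  (∀ (S : Subset n) → IsZeroForcingSet G S → m ℕ.≤ ∣ S ∣)

-- The real numbers, given abstractly as a Dedekind-complete ordered
-- field (unique up to isomorphism).

record RealField (c ℓ ℓ' : Level) : Set (suc (c ⊔ ℓ ⊔ ℓ')) where
  field
    commRing : CommutativeRing c ℓ
  open CommutativeRing commRing public
  field
    0≉1      : ¬ (0# ≈ 1#)
    inverse  : ∀ x → ¬ (x ≈ 0#) → Σ Carrier λ y → (x * y) ≈ 1#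
    _≤_      : Carrier → Carrier → Set ℓ'
    ≤-resp-≈ : ∀ {x x' y y'} → x ≈ x' → y ≈ y' → x ≤ y → x' ≤ y'
    ≤-refl   : ∀ {x} → x ≤ x
    ≤-trans  : ∀ {x y z} → x ≤ y → y ≤ z → x ≤ z
    ≤-antisym : ∀ {x y} → x ≤ y → y ≤ x → x ≈ y
    ≤-total  : ∀ x y → (x ≤ y) ⊎ (y ≤ x)
    +-mono   : ∀ {x y} z → x ≤ y → (x + z) ≤ (y + z)
    *-nonneg : ∀ {x y} → 0# ≤ x → 0# ≤ y → 0# ≤ (x * y)
    lub      : (P : Carrier → Set (c ⊔ ℓ ⊔ ℓ')) → Σ Carrier P →
               (Σ Carrier λ b → ∀ x → P x → x ≤ b) →
               Σ Carrier λ s → (∀ x → P x → x ≤ s) ×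
                               (∀ b → (∀ x → P x → x ≤ b) → s ≤ b)

module _ {c ℓ ℓ' : Level} (R : RealField c ℓ ℓ') where
  open RealField R

  Σ[<_]_ : (m : ℕ) → (Fin m → Carrier) → Carrier
  Σ[< zero ] f = 0#
  Σ[< ℕ.suc m ] f = f Fin.zero + Σ[< m ] (λ i → f (Fin.suc i))

  Matrix : ℕ → Set c
  Matrix n = Fin n → Fin n → Carrier

  InS : ∀ {n} → Graph n → Matrix n → Set ℓ
  InS G A = (∀ i j → A i j ≈ A j i) ×
            (∀ i j → i ≢ j → ((¬ (A i j ≈ 0#)) ⇔ G i j))

  InKernel : ∀ {n} → Matrix n → (Fin n → Carrier) → Set ℓ
  InKernel {n} A x = ∀ i → Σ[< n ] (λ j → A i j * x j) ≈ 0#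

  LinearlyIndependent : ∀ {n m} → (Fin m → Fin n → Carrier) → Set (c ⊔ ℓ)
  LinearlyIndependent {n} {m} xs =
    ∀ (a : Fin m → Carrier) →
      (∀ i → Σ[< m ] (λ r → a r * xs r i) ≈ 0#) → ∀ r → a r ≈ 0#

  NullityAtLeast : ∀ {n} → Matrix n → ℕ → Set (c ⊔ ℓ)
  NullityAtLeast {n} A m =
    Σ (Fin m → Fin n → Carrier) λ xs →
      (∀ r → InKernel A (xs r)) × LinearlyIndependent xs

  IsMaximumNullity : ∀ {n} → Graph n → ℕ → Set (c ⊔ ℓ)
  IsMaximumNullity {n} G m =
    (Σ (Matrix n) λ A → InS G A × NullityAtLeast A m) ×
    (∀ A → InS G A → ¬ NullityAtLeast A (ℕ.suc m))

-- The cubic graph of the theorem on n = 6k vertices.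
-- Vertex 6ℓ + p (0 ≤ ℓ < k, 0 ≤ p < 6) is the p-th of a_ℓ,b_ℓ,c_ℓ,d_ℓ,e_ℓ,f_ℓ
-- (blocks indexed from 0 instead of 1).

innerEdge : ℕ → ℕ → Bool
innerEdge 0 1 = true
innerEdge 1 0 = true
innerEdge 0 2 = true
innerEdge 2 0 = true
innerEdge 1 3 = true
innerEdge 3 1 = true
innerEdge 1 4 = true
innerEdge 4 1 = true
innerEdge 2 3 = true
innerEdge 3 2 = true
innerEdge 2 4 = true
innerEdge 4 2 = true
innerEdge 3 5 = true
innerEdge 5 3 = true
innerEdge 4 5 = true
innerEdge 5 4 = true
innerEdge _ _ = false

nextBlock : ℕ → ℕ → ℕ
nextBlock k ℓ = if (ℕ.suc ℓ ≡ᵇ k) then 0 else ℕ.suc ℓ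
  where open import Data.Bool using (if_then_else_)

linkEdge : ℕ → ℕ → ℕ → Bool
linkEdge k i j = (i % 6 ≡ᵇ 5) ∧ ((j % 6 ≡ᵇ 0) ∧ (nextBlock k (i / 6) ≡ᵇ j / 6))

adjℕ : ℕ → ℕ → ℕ → Bool
adjℕ k i j = ((i / 6 ≡ᵇ j / 6) ∧ innerEdge (i % 6) (j % 6))
             ∨ (linkEdge k i j ∨ linkEdge k j i)

cubicGraph : (k : ℕ) → Graph (6 ℕ.* k)
cubicGraph k u v = T (adjℕ k (toℕ u) (toℕ v))

{-# OPTIONS --safe #-}

-- The nullity of any A ∈ S(G) is at most the size of any zero forcing set S: otherwise some nonzero
-- null vector vanishes on S, and then on every vertex, because in the row of A at a forcing vertex only
-- the term at the forced vertex is not already known to vanish. Hence Z(G) = M(G) = |S| as soon as some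
-- A ∈ S(G) has nullity |S|.
--
-- For the cubic graph take S = {a₀, f₀} ∪ {b_ℓ, d_ℓ}, of size 2k + 2 = n/3 + 2: in each block d forces c
-- and b forces e, then f_ℓ forces a_{ℓ+1}, which forces c_{ℓ+1}, and d_{ℓ+1} forces f_{ℓ+1}. The adjacency
-- matrix has, for each v ∈ S, a null vector that is 1 at v and 0 on the rest of S: e_b − e_c and e_d − e_e
-- in each block (b, c and d, e are twins), and Σ_ℓ (e_{a_ℓ} − e_{e_ℓ}) and Σ_ℓ (e_{f_ℓ} − e_{c_ℓ}), which are
-- null because forgetting blocks maps the graph onto K₃,₃, where a, e and f, c are twins.

module Submission where

open import Defs
open import Level using (Level; _⊔_)
open import Data.Bool as Bool using (Bool; true; false; T; _∧_; _∨_; if_then_else_)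
open import Data.Bool.Properties using (T-∧; T-∨; T-≡; ∨-identityʳ; ∨-comm)
open import Data.Nat as ℕ using (ℕ; zero; suc; s≤s; z<s; _≡ᵇ_)
open import Data.Nat.Properties as ℕₚ using (≡ᵇ⇒≡; ≡⇒≡ᵇ)
open import Data.Nat.DivMod
  using (m≡m%n+[m/n]*n; [m+kn]%n≡m%n; [m+n]%n≡m%n; +-distrib-/-∣ʳ; m<n⇒m/n≡0; m*n/n≡m; m<n⇒m%n≡m;
         m<n*o⇒m/o<n; _mod_)
open import Data.Nat.Divisibility using (divides)
open import Data.Nat.Tactic.RingSolver using (solve-∀)
open import Data.Fin as Fin using (Fin; zero; suc; toℕ; fromℕ; fromℕ<; inject₁; punchIn; punchOut)
open import Data.Fin.Patterns using (0F; 1F; 2F; 3F; 4F; 5F)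
open import Data.Fin.Properties
  using (toℕ-fromℕ<; toℕ-fromℕ; toℕ-inject₁; toℕ-inject₁-≢; toℕ-injective; toℕ<n; suc-injective;
         punchInᵢ≢i; punchIn-punchOut; all?; any?)
  renaming (_≟_ to _≟ᶠ_)
open import Data.Fin.Induction using (<-weakInduction)
open import Data.Fin.Subset using (Subset; _∈_; ∣_∣; inside; outside)
open import Data.Vec using (Vec; []; _∷_; lookup; tabulate; here; there)
open import Data.Vec.Properties using (lookup∘tabulate; lookup⇒[]=; []=⇒lookup)
open import Data.Product using (∃-syntax; _×_; _,_; proj₁; proj₂)
open import Data.Sum using (_⊎_; inj₁; inj₂)
open import Data.Unit using (tt)
open import Function using (_∘_; id; _⇔_)
open import Function.Bundles using (Equivalence; mk⇔)
open import Relation.Nullary using (¬_; Dec; yes; no; does; contradiction)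
open import Relation.Nullary.Negation using (DoubleNegation; ¬¬-map; negated-stable)
open import Relation.Nullary.Decidable using (¬¬-excluded-middle; from-yes; T?; _→-dec_; _×-dec_)
open import Relation.Binary.PropositionalEquality as ≡ using (_≡_; _≢_)

-- Equality of reals is undecidable, so Gaussian elimination and the propagation of zeros along
-- forcing chains are done under a double negation; the nullity bound they serve is a negation.
module DoubleNegationMonad where

  return : ∀ {a} {A : Set a} → A → DoubleNegation A
  return x ¬x = ¬x x

  _>>=_ : ∀ {a b} {A : Set a} {B : Set b} →
          DoubleNegation A → (A → DoubleNegation B) → DoubleNegation B
  m >>= f = negated-stable (¬¬-map f m)

  ¬¬-∀-Fin : ∀ {a n} {P : Fin n → Set a} →
             (∀ i → DoubleNegation (P i)) → DoubleNegation (∀ i → P i)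
  ¬¬-∀-Fin {n = zero}  ¬¬P ¬∀P = ¬∀P λ ()
  ¬¬-∀-Fin {n = suc n} ¬¬P ¬∀P =
    ¬¬P zero λ P₀ → ¬¬-∀-Fin (¬¬P ∘ suc) λ Pₛ → ¬∀P λ { zero → P₀ ; (suc i) → Pₛ i }

open DoubleNegationMonad

elements : ∀ {n} (S : Subset n) → Fin ∣ S ∣ → Fin n
elements (inside  ∷ S) zero    = zero
elements (inside  ∷ S) (suc i) = suc (elements S i)
elements (outside ∷ S) i       = suc (elements S i)

elements-onto : ∀ {n} (S : Subset n) {v} → v ∈ S → ∃[ i ] elements S i ≡ v
elements-onto (inside  ∷ S) here = zero , ≡.refl
elements-onto (inside  ∷ S) (there v∈S) with elements-onto S v∈S
... | i , ≡.refl = suc i , ≡.refl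
elements-onto (outside ∷ S) (there v∈S) with elements-onto S v∈S
... | i , ≡.refl = i , ≡.refl

elements-∈ : ∀ {n} (S : Subset n) i → elements S i ∈ S
elements-∈ (inside  ∷ S) zero    = here
elements-∈ (inside  ∷ S) (suc i) = there (elements-∈ S i)
elements-∈ (outside ∷ S) i       = there (elements-∈ S i)

elements-injective : ∀ {n} (S : Subset n) {i j} → elements S i ≡ elements S j → i ≡ j
elements-injective (inside  ∷ S) {zero}  {zero}  _  = ≡.refl
elements-injective (inside  ∷ S) {suc i} {suc j} eq = ≡.cong suc (elements-injective S (suc-injective eq))
elements-injective (outside ∷ S)                 eq = elements-injective S (suc-injective eq)

module LinearAlgebra {c ℓ ℓ' : Level} (R : RealField c ℓ ℓ') where

  open RealField R hiding (zero)
  open import Algebra.Properties.Ring ring using (-‿distribʳ-*; -‿distribˡ-*; -1*x≈-x; x[y-z]≈xy-xz)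
  open import Algebra.Properties.Semiring.Sum semiring
    using (sum; sum-remove; sum-cong-≋; sum-replicate-zero; ∑-distrib-+; ∑-comm; *-distribˡ-sum)
  open import Algebra.Properties.Group +-group using (ε⁻¹≈ε)
  open import Relation.Binary.Reasoning.Setoid setoid

  Σ[<]≡sum : ∀ n (f : Fin n → Carrier) → Σ[<_]_ R n f ≡ sum f
  Σ[<]≡sum zero    f = ≡.refl
  Σ[<]≡sum (suc n) f = ≡.cong (f zero +_) (Σ[<]≡sum n (f ∘ suc))

  sum-zero : ∀ {n} {f : Fin n → Carrier} → (∀ i → f i ≈ 0#) → sum f ≈ 0#
  sum-zero {n} f≈0 = trans (sum-cong-≋ f≈0) (sum-replicate-zero n)

  sum-single : ∀ {n} (f : Fin n → Carrier) i → (∀ j → j ≢ i → f j ≈ 0#) → sum f ≈ f i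
  sum-single {suc n} f i f≈0 = begin
    sum f                                   ≈⟨ sum-remove {i = i} f ⟩
    f i + sum (λ j → f (punchIn i j))       ≈⟨ +-congˡ (sum-zero λ j → f≈0 _ (punchInᵢ≢i i j)) ⟩
    f i + 0#                                ≈⟨ +-identityʳ _ ⟩
    f i                                     ∎

  x*y≈0⇒y≈0 : ∀ {x y} → ¬ x ≈ 0# → x * y ≈ 0# → y ≈ 0#
  x*y≈0⇒y≈0 {x} {y} x≉0 xy≈0 with inverse x x≉0
  ... | x⁻¹ , xx⁻¹≈1 = begin
    y                ≈⟨ *-identityˡ y ⟨
    1# * y           ≈⟨ *-congʳ (trans (*-comm x⁻¹ x) xx⁻¹≈1) ⟨
    (x⁻¹ * x) * y    ≈⟨ *-assoc x⁻¹ x y ⟩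
    x⁻¹ * (x * y)    ≈⟨ *-congˡ xy≈0 ⟩
    x⁻¹ * 0#         ≈⟨ zeroʳ x⁻¹ ⟩
    0#               ∎

  Nontrivial : ∀ {N} → (Fin N → Carrier) → Set ℓ
  Nontrivial x = ∃[ r ] ¬ x r ≈ 0#

  Solves : ∀ {E N} → (Fin E → Fin N → Carrier) → (Fin N → Carrier) → Set ℓ
  Solves M x = ∀ e → sum (λ r → M e r * x r) ≈ 0#

  HasNontrivialSolution : ∀ {E N} → (Fin E → Fin N → Carrier) → Set (c ⊔ ℓ)
  HasNontrivialSolution M = ∃[ x ] Nontrivial x × Solves M x

  ¬¬-zero-or-nontrivial : ∀ {N} (x : Fin N → Carrier) →
                          DoubleNegation ((∀ r → x r ≈ 0#) ⊎ Nontrivial x)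
  ¬¬-zero-or-nontrivial x = do
    no trivial ← ¬¬-excluded-middle {A = Nontrivial x}
      where yes nontrivial → return (inj₂ nontrivial)
    x≈0 ← ¬¬-∀-Fin λ r x≉0 → trivial (r , x≉0)
    return (inj₁ x≈0)

  module Elimination {E N} (M : Fin (suc E) → Fin (suc N) → Carrier)
                     (p : Fin (suc E)) (π≉0 : ¬ M p zero ≈ 0#) where

    π⁻¹ : Carrier
    π⁻¹ = proj₁ (inverse (M p zero) π≉0)

    multiplier : Fin (suc E) → Carrier
    multiplier e = - (M e zero * π⁻¹)

    reduced : Fin E → Fin N → Carrier
    reduced i r = M (punchIn p i) (suc r) + multiplier (punchIn p i) * M p (suc r)

    tailRow : Fin (suc E) → (Fin N → Carrier) → Carrier
    tailRow e y = sum (λ r → M e (suc r) * y r)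

    extend : (Fin N → Carrier) → Fin (suc N) → Carrier
    extend y zero    = - (π⁻¹ * tailRow p y)
    extend y (suc r) = y r

    head-term : ∀ e y → M e zero * extend y zero ≈ multiplier e * tailRow p y
    head-term e y = begin
      M e zero * - (π⁻¹ * P)     ≈⟨ -‿distribʳ-* (M e zero) _ ⟨
      - (M e zero * (π⁻¹ * P))   ≈⟨ -‿cong (*-assoc (M e zero) π⁻¹ P) ⟨
      - (M e zero * π⁻¹ * P)     ≈⟨ -‿distribˡ-* (M e zero * π⁻¹) P ⟩
      multiplier e * P           ∎
      where P = tailRow p y

    reduced-row : ∀ i y → sum (λ r → reduced i r * y r) ≈
                          tailRow (punchIn p i) y + multiplier (punchIn p i) * tailRow p y
    reduced-row i y = begin
      sum (λ r → (M e (suc r) + μ * M p (suc r)) * y r)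
        ≈⟨ sum-cong-≋ (λ r → trans (distribʳ (y r) _ _) (+-congˡ (*-assoc μ _ _))) ⟩
      sum (λ r → M e (suc r) * y r + μ * (M p (suc r) * y r))
        ≈⟨ ∑-distrib-+ (λ r → M e (suc r) * y r) _ ⟩
      tailRow e y + sum (λ r → μ * (M p (suc r) * y r))
        ≈⟨ +-congˡ (*-distribˡ-sum μ (λ r → M p (suc r) * y r)) ⟨
      tailRow e y + μ * tailRow p y
        ∎
      where e = punchIn p i
            μ = multiplier e

    extend-solves : ∀ {y} → Solves reduced y → Solves M (extend y)
    extend-solves {y} solves e with e ≟ᶠ p
    ... | yes ≡.refl = begin
      M p zero * extend y zero + tailRow p y       ≈⟨ +-congʳ (head-term p y) ⟩
      - (M p zero * π⁻¹) * P + P                   ≈⟨ +-congʳ (*-congʳ (-‿cong (proj₂ (inverse _ π≉0)))) ⟩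
      - 1# * P + P                                 ≈⟨ +-congʳ (-‿distribˡ-* 1# P) ⟨
      - (1# * P) + P                               ≈⟨ +-congʳ (-‿cong (*-identityˡ P)) ⟩
      - P + P                                      ≈⟨ -‿inverseˡ P ⟩
      0#                                           ∎
      where P = tailRow p y
    ... | no e≢p = ≡.subst (λ e → sum (λ r → M e r * extend y r) ≈ 0#)
                           (punchIn-punchOut (e≢p ∘ ≡.sym)) (non-pivot-row (punchOut (e≢p ∘ ≡.sym)))
      where
      non-pivot-row : ∀ i → sum (λ r → M (punchIn p i) r * extend y r) ≈ 0#
      non-pivot-row i = begin
        M eᵢ zero * extend y zero + tailRow eᵢ y       ≈⟨ +-congʳ (head-term eᵢ y) ⟩
        multiplier eᵢ * tailRow p y + tailRow eᵢ y     ≈⟨ +-comm _ _ ⟩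
        tailRow eᵢ y + multiplier eᵢ * tailRow p y     ≈⟨ reduced-row i y ⟨
        sum (λ r → reduced i r * y r)                ≈⟨ solves i ⟩
        0#                                           ∎
        where eᵢ = punchIn p i

    extend-solution : HasNontrivialSolution reduced → HasNontrivialSolution M
    extend-solution (y , (r , y≉0) , solves) = extend y , (suc r , y≉0) , extend-solves solves

  underdetermined⇒¬¬nontrivial-solution : ∀ {E N} → E ℕ.< N → (M : Fin E → Fin N → Carrier) →
                                           DoubleNegation (HasNontrivialSolution M)
  underdetermined⇒¬¬nontrivial-solution {E} {suc N} E<1+N M = do
    inj₂ (p , π≉0) ← ¬¬-zero-or-nontrivial (λ e → M e zero)
      where inj₁ column≈0 → return (unit , (zero , 0≉1 ∘ sym) , unit-solves column≈0)
    eliminate E<1+N M p π≉0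
    where
    unit : Fin (suc N) → Carrier
    unit zero    = 1#
    unit (suc _) = 0#

    unit-solves : (∀ e → M e zero ≈ 0#) → Solves M unit
    unit-solves column≈0 e =
      trans (+-cong (trans (*-congʳ (column≈0 e)) (zeroˡ 1#)) (sum-zero {N} λ r → zeroʳ (M e (suc r))))
            (+-identityʳ 0#)

    eliminate : ∀ {E} → E ℕ.< suc N → (M : Fin E → Fin (suc N) → Carrier) →
                (p : Fin E) → ¬ M p zero ≈ 0# → DoubleNegation (HasNontrivialSolution M)
    eliminate {suc E} (s≤s E<N) M p π≉0 =
      ¬¬-map (extend-solution) (underdetermined⇒¬¬nontrivial-solution E<N reduced)
      where open Elimination M p π≉0

  combination-in-kernel : ∀ {n m} (A : Matrix R n) (a : Fin m → Carrier) (xs : Fin m → Fin n → Carrier) →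
                          (∀ r u → sum (λ j → A u j * xs r j) ≈ 0#) →
                          ∀ u → sum (λ j → A u j * sum (λ r → a r * xs r j)) ≈ 0#
  combination-in-kernel A a xs xs∈ker u = begin
    sum (λ j → A u j * sum (λ r → a r * xs r j))
      ≈⟨ sum-cong-≋ (λ j → *-distribˡ-sum (A u j) (λ r → a r * xs r j)) ⟩
    sum (λ j → sum (λ r → A u j * (a r * xs r j)))
      ≈⟨ sum-cong-≋ (λ j → sum-cong-≋ λ r → x∙yz≈y∙xz (A u j) (a r) (xs r j)) ⟩
    sum (λ j → sum (λ r → a r * (A u j * xs r j)))
      ≈⟨ ∑-comm (λ j r → a r * (A u j * xs r j)) ⟩
    sum (λ r → sum (λ j → a r * (A u j * xs r j)))
      ≈⟨ sum-cong-≋ (λ r → *-distribˡ-sum (a r) (λ j → A u j * xs r j)) ⟨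
    sum (λ r → a r * sum (λ j → A u j * xs r j))
      ≈⟨ sum-zero (λ r → trans (*-congˡ (xs∈ker r u)) (zeroʳ (a r))) ⟩
    0#
      ∎
    where open import Algebra.Properties.CommutativeSemigroup *-commutativeSemigroup using (x∙yz≈y∙xz)

  module _ {n} {G : Graph n} {S : Subset n} {A : Matrix R n} (A∈S : InS R G A)
           {y : Fin n → Carrier} (y∈ker : ∀ u → sum (λ j → A u j * y j) ≈ 0#)
           (y|S≈0 : ∀ {v} → v ∈ S → y v ≈ 0#) where

    ¬¬-nonadjacent-entry≈0 : ∀ {u j} → u ≢ j → ¬ G u j → DoubleNegation (A u j ≈ 0#)
    ¬¬-nonadjacent-entry≈0 {u} {j} u≢j ¬Guj Auj≉0 = ¬Guj (Equivalence.to (proj₂ A∈S u j u≢j) Auj≉0)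

    forced⇒¬¬zero : ∀ {v} → Black G S v → DoubleNegation (y v ≈ 0#)
    forced⇒¬¬zero (initial v∈S) = return (y|S≈0 v∈S)
    forced⇒¬¬zero (force {u} {v} Guv u-black others-black) with u ≟ᶠ v
    ... | yes ≡.refl = forced⇒¬¬zero u-black
    ... | no u≢v = do
      yu≈0 ← forced⇒¬¬zero u-black
      others≈0 ← ¬¬-∀-Fin (other-term yu≈0)
      return (x*y≈0⇒y≈0 (Equivalence.from (proj₂ A∈S u v u≢v) Guv)
                         (trans (sym (sum-single _ v others≈0)) (y∈ker u)))
      where
      other-term : y u ≈ 0# → ∀ j → DoubleNegation (j ≢ v → A u j * y j ≈ 0#)
      other-term yu≈0 j with j ≟ᶠ v | j ≟ᶠ u
      ... | yes j≡v    | _          = return (contradiction j≡v)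
      ... | no _       | yes ≡.refl = return (λ _ → trans (*-congˡ yu≈0) (zeroʳ _))
      ... | no j≢v     | no j≢u     = do
        yes Guj ← ¬¬-excluded-middle {A = G u j}
          where no ¬Guj → ¬¬-map (λ Auj≈0 _ → trans (*-congʳ Auj≈0) (zeroˡ _))
                                  (¬¬-nonadjacent-entry≈0 (j≢u ∘ ≡.sym) ¬Guj)
        ¬¬-map (λ yj≈0 _ → trans (*-congˡ yj≈0) (zeroʳ _)) (forced⇒¬¬zero (others-black j Guj j≢v))

  nullity≤zero-forcing-set : ∀ {n} {G : Graph n} {S A m} → IsZeroForcingSet G S → InS R G A →
                             ∣ S ∣ ℕ.< m → ¬ NullityAtLeast R A m
  nullity≤zero-forcing-set {n} {G} {S} {A} {m} forcing A∈S |S|<m (xs , xs∈ker , independent) =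
    underdetermined⇒¬¬nontrivial-solution |S|<m (λ e r → xs r (elements S e)) no-solution
    where
    xs∈ker′ : ∀ r u → sum (λ j → A u j * xs r j) ≈ 0#
    xs∈ker′ r u = ≡.subst (_≈ 0#) (Σ[<]≡sum n _) (xs∈ker r u)

    no-solution : ¬ HasNontrivialSolution (λ e r → xs r (elements S e))
    no-solution (a , (r , a≉0) , a-solves) =
      ¬¬-∀-Fin (λ v → forced⇒¬¬zero A∈S (combination-in-kernel A a xs xs∈ker′) y|S≈0 (forcing v))
        λ y≈0 → a≉0 (independent a (λ j → ≡.subst (_≈ 0#) (≡.sym (Σ[<]≡sum m _)) (y≈0 j)) r)
      where
      y|S≈0 : ∀ {v} → v ∈ S → sum (λ r → a r * xs r v) ≈ 0#
      y|S≈0 v∈S with elements-onto S v∈S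
      ... | e , ≡.refl = trans (sum-cong-≋ λ r → *-comm (a r) _) (a-solves e)

  zero-forcing-number≡maximum-nullity : ∀ {n} {G : Graph n} {S A} → IsZeroForcingSet G S → InS R G A →
    NullityAtLeast R A ∣ S ∣ → IsZeroForcingNumber G ∣ S ∣ × IsMaximumNullity R G ∣ S ∣
  zero-forcing-number≡maximum-nullity {S = S} {A} forcing A∈S nullity≥∣S∣ =
    ((S , forcing , ≡.refl) , λ S' forcing' → ℕₚ.≮⇒≥ λ ∣S'∣<∣S∣ →
        nullity≤zero-forcing-set forcing' A∈S ∣S'∣<∣S∣ nullity≥∣S∣) ,
    ((A , A∈S , nullity≥∣S∣) , λ A' A'∈S → nullity≤zero-forcing-set forcing A'∈S ℕₚ.≤-refl)

  x-y≈x : ∀ {x y} → y ≈ 0# → x - y ≈ x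
  x-y≈x {x} y≈0 = trans (+-congˡ (trans (-‿cong y≈0) ε⁻¹≈ε)) (+-identityʳ x)

  indicator : Bool → Carrier
  indicator b = if b then 1# else 0#

  δ : ∀ {n} → Fin n → Fin n → Carrier
  δ i j = indicator (does (i ≟ᶠ j))

  δ-refl : ∀ {n} (i : Fin n) → δ i i ≈ 1#
  δ-refl i with i ≟ᶠ i
  ... | yes _   = refl
  ... | no i≢i = contradiction ≡.refl i≢i

  δ-≢ : ∀ {n} {i j : Fin n} → i ≢ j → δ i j ≈ 0#
  δ-≢ {i = i} {j} i≢j with i ≟ᶠ j
  ... | yes i≡j = contradiction i≡j i≢j
  ... | no _    = refl

  sum-δ* : ∀ {n} (f : Fin n → Carrier) i → sum (λ j → δ i j * f j) ≈ f i
  sum-δ* f i = begin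
    sum (λ j → δ i j * f j)    ≈⟨ sum-single _ i (λ j j≢i → trans (*-congʳ (δ-≢ (j≢i ∘ ≡.sym))) (zeroˡ (f j))) ⟩
    δ i i * f i                ≈⟨ *-congʳ (δ-refl i) ⟩
    1# * f i                   ≈⟨ *-identityˡ (f i) ⟩
    f i                        ∎

  sum-δ-injective : ∀ {m n} (f : Fin m → Fin n) → (∀ {q q'} → f q ≡ f q' → q ≡ q') →
                    ∀ x → sum (λ q → δ x (f q)) ≈ indicator (does (any? λ q → x ≟ᶠ f q))
  sum-δ-injective f f-injective x with any? (λ q → x ≟ᶠ f q)
  ... | yes (q , ≡.refl) = trans (sum-single _ q λ q' q'≢q → δ-≢ (q'≢q ∘ ≡.sym ∘ f-injective)) (δ-refl (f q))
  ... | no x∉f           = sum-zero λ q → δ-≢ λ x≡fq → x∉f (q , x≡fq)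

  sum-neg : ∀ {n} (f : Fin n → Carrier) → sum (λ j → - f j) ≈ - sum f
  sum-neg f = begin
    sum (λ j → - f j)          ≈⟨ sum-cong-≋ (λ j → -1*x≈-x (f j)) ⟨
    sum (λ j → - 1# * f j)     ≈⟨ *-distribˡ-sum (- 1#) f ⟨
    - 1# * sum f               ≈⟨ -1*x≈-x (sum f) ⟩
    - sum f                    ∎

  difference-in-kernel : ∀ {n} (A : Matrix R n) (x y : Fin n → Carrier) →
                         (∀ i → sum (λ j → A i j * x j) ≈ sum (λ j → A i j * y j)) →
                         ∀ i → sum (λ j → A i j * (x j - y j)) ≈ 0#
  difference-in-kernel A x y Ax≈Ay i = begin
    sum (λ j → A i j * (x j - y j))                          ≈⟨ sum-cong-≋ (λ j → x[y-z]≈xy-xz (A i j) (x j) (y j)) ⟩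
    sum (λ j → A i j * x j - A i j * y j)                    ≈⟨ ∑-distrib-+ (λ j → A i j * x j) _ ⟩
    sum (λ j → A i j * x j) + sum (λ j → - (A i j * y j))    ≈⟨ +-cong (Ax≈Ay i) (sum-neg (λ j → A i j * y j)) ⟩
    sum (λ j → A i j * y j) - sum (λ j → A i j * y j)        ≈⟨ -‿inverseʳ _ ⟩
    0#                                                       ∎

  diagonal⇒independent : ∀ {n m} (xs : Fin m → Fin n → Carrier) (pivot : Fin m → Fin n) →
                         (∀ r → ¬ xs r (pivot r) ≈ 0#) → (∀ r r' → r' ≢ r → xs r' (pivot r) ≈ 0#) →
                         LinearlyIndependent R xs
  diagonal⇒independent {n} {m} xs pivot diagonal off-diagonal a combination≈0 r =
    x*y≈0⇒y≈0 (diagonal r) (begin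
      xs r (pivot r) * a r                          ≈⟨ *-comm _ (a r) ⟩
      a r * xs r (pivot r)                          ≈⟨ sum-single _ r (λ r' r'≢r →
                                                         trans (*-congˡ (off-diagonal r r' r'≢r)) (zeroʳ (a r'))) ⟨
      sum (λ r' → a r' * xs r' (pivot r))           ≡⟨ Σ[<]≡sum m _ ⟨
      Σ[<_]_ R m (λ r' → a r' * xs r' (pivot r))    ≈⟨ combination≈0 (pivot r) ⟩
      0#                                            ∎)

pattern pa = 0F
pattern pb = 1F
pattern pc = 2F
pattern pd = 3F
pattern pe = 4F
pattern pf = 5F

-- Positions 0, …, 5 are a, …, f. Slot 2 of a and of f is the edge f_ℓ a_{ℓ+1} between consecutive
-- blocks; all other slots stay inside the block.
neighbourPositions : Fin 6 → Vec (Fin 6) 3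
neighbourPositions pa = pb ∷ pc ∷ pf ∷ []
neighbourPositions pb = pa ∷ pd ∷ pe ∷ []
neighbourPositions pc = pa ∷ pd ∷ pe ∷ []
neighbourPositions pd = pb ∷ pc ∷ pf ∷ []
neighbourPositions pe = pb ∷ pc ∷ pf ∷ []
neighbourPositions pf = pd ∷ pe ∷ pa ∷ []

neighbourPosition : Fin 6 → Fin 3 → Fin 6
neighbourPosition p = lookup (neighbourPositions p)

innerEdge? : Fin 6 → Fin 6 → Bool
innerEdge? p p' = innerEdge (toℕ p) (toℕ p')

innerEdge-sym : ∀ p p' → innerEdge? p p' ≡ innerEdge? p' p
innerEdge-sym = from-yes (all? λ p → all? λ p' → innerEdge? p p' Bool.≟ innerEdge? p' p)

neighbourPosition-injective : ∀ p q q' → neighbourPosition p q ≡ neighbourPosition p q' → q ≡ q'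
neighbourPosition-injective = from-yes (all? λ p → all? λ q → all? λ q' →
  (neighbourPosition p q ≟ᶠ neighbourPosition p q') →-dec (q ≟ᶠ q'))

inner-slots : ∀ p → T (innerEdge? p (neighbourPosition p 0F)) × T (innerEdge? p (neighbourPosition p 1F))
inner-slots = from-yes (all? λ p →
  T? (innerEdge? p (neighbourPosition p 0F)) ×-dec T? (innerEdge? p (neighbourPosition p 1F)))

innerEdge⇒neighbour : ∀ p p' → T (innerEdge? p p') → ∃[ q ] p' ≡ neighbourPosition p q
innerEdge⇒neighbour = from-yes (all? λ p → all? λ p' →
  T? (innerEdge? p p') →-dec any? λ q → p' ≟ᶠ neighbourPosition p q)

≡ᵇ-sym : ∀ m n → (m ≡ᵇ n) ≡ (n ≡ᵇ m)
≡ᵇ-sym zero    zero    = ≡.refl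
≡ᵇ-sym zero    (suc n) = ≡.refl
≡ᵇ-sym (suc m) zero    = ≡.refl
≡ᵇ-sym (suc m) (suc n) = ≡ᵇ-sym m n

module Counting where

  open import Data.Nat using (_+_; _*_)

  countBelow : (ℕ → Bool) → ℕ → ℕ
  countBelow f zero    = 0
  countBelow f (suc m) = if f 0 then suc (countBelow (f ∘ suc) m) else countBelow (f ∘ suc) m

  ∣tabulate∣≡countBelow : ∀ m (f : ℕ → Bool) → ∣ tabulate {n = m} (f ∘ toℕ) ∣ ≡ countBelow f m
  ∣tabulate∣≡countBelow zero    f = ≡.refl
  ∣tabulate∣≡countBelow (suc m) f with f 0
  ... | true  = ≡.cong suc (∣tabulate∣≡countBelow m (f ∘ suc))
  ... | false = ∣tabulate∣≡countBelow m (f ∘ suc)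

  countBelow-cong : ∀ m {f g : ℕ → Bool} → (∀ x → f x ≡ g x) → countBelow f m ≡ countBelow g m
  countBelow-cong zero    f≗g = ≡.refl
  countBelow-cong (suc m) f≗g rewrite f≗g 0 =
    ≡.cong (λ c → if _ then suc c else c) (countBelow-cong m (f≗g ∘ suc))

  countBelow-+ : ∀ m m' f → countBelow f (m + m') ≡ countBelow f m + countBelow (λ x → f (m + x)) m'
  countBelow-+ zero    m' f = ≡.refl
  countBelow-+ (suc m) m' f with f 0
  ... | true  = ≡.cong suc (countBelow-+ m m' (f ∘ suc))
  ... | false = countBelow-+ m m' (f ∘ suc)

  countBelow-periodic : ∀ d f → (∀ x → f (d + x) ≡ f x) → ∀ j → countBelow f (j * d) ≡ j * countBelow f d
  countBelow-periodic d f periodic zero    = ≡.refl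
  countBelow-periodic d f periodic (suc j) =
    ≡.trans (countBelow-+ d (j * d) f) (≡.cong (countBelow f d +_)
      (≡.trans (countBelow-cong (j * d) periodic) (countBelow-periodic d f periodic j)))

open Counting

module CubicGraph (k₀ : ℕ) where

  open import Data.Nat using (_<_; _+_; _*_; _/_; _%_)

  k : ℕ
  k = suc k₀

  n : ℕ
  n = 6 * k

  G : Graph n
  G = cubicGraph k

  nextBlock-cases : ∀ m → (suc m ≡ k × nextBlock k m ≡ 0) ⊎ (suc m ≢ k × nextBlock k m ≡ suc m)
  nextBlock-cases m with suc m ≡ᵇ k in eq
  ... | true  = inj₁ (≡ᵇ⇒≡ (suc m) k (≡.subst T (≡.sym eq) tt) , ≡.refl)
  ... | false = inj₂ ((λ e → ≡.subst T eq (≡⇒≡ᵇ (suc m) k e)) , ≡.refl)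

  nextBlock<k : ∀ {m} → m < k → nextBlock k m < k
  nextBlock<k {m} m<k with nextBlock-cases m
  ... | inj₁ (_ , next≡0)     = ≡.subst (_< k) (≡.sym next≡0) z<s
  ... | inj₂ (1+m≢k , next≡1+m) = ≡.subst (_< k) (≡.sym next≡1+m) (ℕₚ.≤∧≢⇒< m<k 1+m≢k)

  next : Fin k → Fin k
  next ℓ = fromℕ< (nextBlock<k (toℕ<n ℓ))

  prev : Fin k → Fin k
  prev zero    = fromℕ k₀
  prev (suc ℓ) = inject₁ ℓ

  toℕ-next : ∀ ℓ → toℕ (next ℓ) ≡ nextBlock k (toℕ ℓ)
  toℕ-next ℓ = toℕ-fromℕ< _

  nextBlock≡⇒≡prev : ∀ ℓ' ℓ → nextBlock k (toℕ ℓ') ≡ toℕ ℓ → ℓ' ≡ prev ℓ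
  nextBlock≡⇒≡prev ℓ' ℓ eq with nextBlock-cases (toℕ ℓ') | ℓ
  ... | inj₁ (1+ℓ'≡k , _)    | zero  = toℕ-injective (≡.trans (ℕₚ.suc-injective 1+ℓ'≡k) (≡.sym (toℕ-fromℕ k₀)))
  ... | inj₁ (_ , next≡0)    | suc m = contradiction (≡.trans (≡.sym next≡0) eq) λ ()
  ... | inj₂ (_ , next≡1+ℓ') | zero  = contradiction (≡.trans (≡.sym next≡1+ℓ') eq) λ ()
  ... | inj₂ (_ , next≡1+ℓ') | suc m =
    toℕ-injective (≡.trans (ℕₚ.suc-injective (≡.trans (≡.sym next≡1+ℓ') eq)) (≡.sym (toℕ-inject₁ m)))

  nextBlock-prev : ∀ ℓ → nextBlock k (toℕ (prev ℓ)) ≡ toℕ ℓ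
  nextBlock-prev zero with nextBlock-cases (toℕ (fromℕ k₀))
  ... | inj₁ (_ , next≡0)  = next≡0
  ... | inj₂ (1+k₀≢k , _)  = contradiction (≡.cong suc (toℕ-fromℕ k₀)) 1+k₀≢k
  nextBlock-prev (suc m) with nextBlock-cases (toℕ (inject₁ m))
  ... | inj₁ (1+m≡k , _)   = contradiction (≡.sym (ℕₚ.suc-injective 1+m≡k)) (toℕ-inject₁-≢ m)
  ... | inj₂ (_ , next≡1+m) = ≡.trans next≡1+m (≡.cong suc (toℕ-inject₁ m))

  block : Fin n → Fin k
  block i = fromℕ< (m<n*o⇒m/o<n (≡.subst (toℕ i <_) (ℕₚ.*-comm 6 k) (toℕ<n i)))

  position : Fin n → Fin 6
  position i = toℕ i mod 6

  toℕ-block : ∀ i → toℕ (block i) ≡ toℕ i / 6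
  toℕ-block i = toℕ-fromℕ< _

  toℕ-position : ∀ i → toℕ (position i) ≡ toℕ i % 6
  toℕ-position i = toℕ-fromℕ< _

  vertex-bound : ∀ (ℓ : Fin k) (p : Fin 6) → toℕ p + toℕ ℓ * 6 < n
  vertex-bound ℓ p = ℕₚ.<-≤-trans (ℕₚ.+-monoˡ-< (toℕ ℓ * 6) (toℕ<n p))
                       (≡.subst (suc (toℕ ℓ) * 6 ℕ.≤_) (ℕₚ.*-comm k 6) (ℕₚ.*-monoˡ-≤ 6 (toℕ<n ℓ)))

  vertex : Fin k → Fin 6 → Fin n
  vertex ℓ p = fromℕ< (vertex-bound ℓ p)

  toℕ-vertex : ∀ ℓ p → toℕ (vertex ℓ p) ≡ toℕ p + toℕ ℓ * 6
  toℕ-vertex ℓ p = toℕ-fromℕ< _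

  block-vertex : ∀ ℓ p → block (vertex ℓ p) ≡ ℓ
  block-vertex ℓ p = toℕ-injective (begin
    toℕ (block (vertex ℓ p))        ≡⟨ toℕ-block (vertex ℓ p) ⟩
    toℕ (vertex ℓ p) / 6            ≡⟨ ≡.cong (_/ 6) (toℕ-vertex ℓ p) ⟩
    (toℕ p + toℕ ℓ * 6) / 6         ≡⟨ +-distrib-/-∣ʳ (toℕ p) (divides (toℕ ℓ) ≡.refl) ⟩
    toℕ p / 6 + toℕ ℓ * 6 / 6       ≡⟨ ≡.cong₂ _+_ (m<n⇒m/n≡0 (toℕ<n p)) (m*n/n≡m (toℕ ℓ) 6) ⟩
    toℕ ℓ                           ∎)
    where open ≡.≡-Reasoning

  vertex%6≡position : ∀ ℓ p → toℕ (vertex ℓ p) % 6 ≡ toℕ p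
  vertex%6≡position ℓ p =
    ≡.trans (≡.cong (_% 6) (toℕ-vertex ℓ p)) (≡.trans ([m+kn]%n≡m%n (toℕ p) (toℕ ℓ) 6) (m<n⇒m%n≡m (toℕ<n p)))

  position-vertex : ∀ ℓ p → position (vertex ℓ p) ≡ p
  position-vertex ℓ p = toℕ-injective (≡.trans (toℕ-position (vertex ℓ p)) (vertex%6≡position ℓ p))

  vertex-coordinates : ∀ i → vertex (block i) (position i) ≡ i
  vertex-coordinates i = toℕ-injective (begin
    toℕ (vertex (block i) (position i))         ≡⟨ toℕ-vertex (block i) (position i) ⟩
    toℕ (position i) + toℕ (block i) * 6        ≡⟨ ≡.cong₂ (λ r q → r + q * 6) (toℕ-position i) (toℕ-block i) ⟩
    toℕ i % 6 + toℕ i / 6 * 6                   ≡⟨ m≡m%n+[m/n]*n (toℕ i) 6 ⟨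
    toℕ i                                       ∎)
    where open ≡.≡-Reasoning

  linkℕ : ℕ → ℕ → ℕ → ℕ → Bool
  linkℕ ℓ p ℓ' p' = (p ≡ᵇ 5) ∧ ((p' ≡ᵇ 0) ∧ (nextBlock k ℓ ≡ᵇ ℓ'))

  adjacentℕ : ℕ → ℕ → ℕ → ℕ → Bool
  adjacentℕ ℓ p ℓ' p' = ((ℓ ≡ᵇ ℓ') ∧ innerEdge p p') ∨ (linkℕ ℓ p ℓ' p' ∨ linkℕ ℓ' p' ℓ p)

  adjacent : Fin k → Fin 6 → Fin k → Fin 6 → Bool
  adjacent ℓ p ℓ' p' = adjacentℕ (toℕ ℓ) (toℕ p) (toℕ ℓ') (toℕ p')

  link : Fin k → Fin 6 → Fin k → Fin 6 → Bool
  link ℓ p ℓ' p' = linkℕ (toℕ ℓ) (toℕ p) (toℕ ℓ') (toℕ p')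

  adjℕ-coordinates : ∀ i j → adjℕ k (toℕ i) (toℕ j) ≡ adjacent (block i) (position i) (block j) (position j)
  adjℕ-coordinates i j = ≡.sym (≡.cong₂ (λ (ℓ , p) (ℓ' , p') → adjacentℕ ℓ p ℓ' p')
    (≡.cong₂ _,_ (toℕ-block i) (toℕ-position i)) (≡.cong₂ _,_ (toℕ-block j) (toℕ-position j)))

  G-coordinates : ∀ i j → G i j ≡ T (adjacent (block i) (position i) (block j) (position j))
  G-coordinates i j = ≡.cong T (adjℕ-coordinates i j)

  adjacent-sym : ∀ ℓ p ℓ' p' → adjacent ℓ p ℓ' p' ≡ adjacent ℓ' p' ℓ p
  adjacent-sym ℓ p ℓ' p' = ≡.cong₂ _∨_ (≡.cong₂ _∧_ (≡ᵇ-sym (toℕ ℓ) (toℕ ℓ')) (innerEdge-sym p p'))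
                                        (∨-comm (link ℓ p ℓ' p') (link ℓ' p' ℓ p))

  linkShift : Fin 6 → Fin k → Fin k
  linkShift pa = prev
  linkShift pf = next
  linkShift _  = id

  neighbourBlock : Fin 6 → Fin 3 → Fin k → Fin k
  neighbourBlock p 2F = linkShift p
  neighbourBlock p _  = id

  innerEdge⇒adjacent : ∀ ℓ p p' → T (innerEdge? p p') → T (adjacent ℓ p ℓ p')
  innerEdge⇒adjacent ℓ p p' t = Equivalence.from T-∨ (inj₁ (Equivalence.from T-∧ (≡⇒≡ᵇ (toℕ ℓ) _ ≡.refl , t)))

  link⇒adjacent : ∀ ℓ p ℓ' p' → T (link ℓ p ℓ' p') ⊎ T (link ℓ' p' ℓ p) → T (adjacent ℓ p ℓ' p')
  link⇒adjacent ℓ p ℓ' p' t =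
    Equivalence.from (T-∨ {(toℕ ℓ ≡ᵇ toℕ ℓ') ∧ innerEdge? p p'}) (inj₂ (Equivalence.from T-∨ t))

  neighbour-adjacent : ∀ ℓ p q → T (adjacent ℓ p (neighbourBlock p q ℓ) (neighbourPosition p q))
  neighbour-adjacent ℓ p  0F = innerEdge⇒adjacent ℓ p _ (proj₁ (inner-slots p))
  neighbour-adjacent ℓ p  1F = innerEdge⇒adjacent ℓ p _ (proj₂ (inner-slots p))
  neighbour-adjacent ℓ pa 2F = link⇒adjacent ℓ pa (prev ℓ) pf (inj₂ (≡⇒≡ᵇ _ _ (nextBlock-prev ℓ)))
  neighbour-adjacent ℓ pb 2F = innerEdge⇒adjacent ℓ pb pe tt
  neighbour-adjacent ℓ pc 2F = innerEdge⇒adjacent ℓ pc pe tt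
  neighbour-adjacent ℓ pd 2F = innerEdge⇒adjacent ℓ pd pf tt
  neighbour-adjacent ℓ pe 2F = innerEdge⇒adjacent ℓ pe pf tt
  neighbour-adjacent ℓ pf 2F = link⇒adjacent ℓ pf (next ℓ) pa (inj₁ (≡⇒≡ᵇ _ _ (≡.sym (toℕ-next ℓ))))

  link⇒coordinates : ∀ ℓ p ℓ' p' → T (link ℓ p ℓ' p') → p ≡ pf × p' ≡ pa × nextBlock k (toℕ ℓ) ≡ toℕ ℓ'
  link⇒coordinates ℓ p ℓ' p' t with Equivalence.to T-∧ t
  ... | p≡5 , t′ with Equivalence.to T-∧ t′
  ... | p'≡0 , next≡ℓ' = toℕ-injective {j = pf} (≡ᵇ⇒≡ _ 5 p≡5) , toℕ-injective {j = pa} (≡ᵇ⇒≡ _ 0 p'≡0) ,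
                         ≡ᵇ⇒≡ _ _ next≡ℓ'

  innerSlot₂-unshifted : ∀ p ℓ → T (innerEdge? p (neighbourPosition p 2F)) → linkShift p ℓ ≡ ℓ
  innerSlot₂-unshifted pa ℓ ()
  innerSlot₂-unshifted pb ℓ _ = ≡.refl
  innerSlot₂-unshifted pc ℓ _ = ≡.refl
  innerSlot₂-unshifted pd ℓ _ = ≡.refl
  innerSlot₂-unshifted pe ℓ _ = ≡.refl
  innerSlot₂-unshifted pf ℓ ()

  adjacent⇒neighbour : ∀ ℓ p ℓ' p' → T (adjacent ℓ p ℓ' p') →
                       ∃[ q ] ℓ' ≡ neighbourBlock p q ℓ × p' ≡ neighbourPosition p q
  adjacent⇒neighbour ℓ p ℓ' p' t with Equivalence.to T-∨ t
  ... | inj₁ inner-edge with Equivalence.to T-∧ inner-edge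
  ... | ℓ≡ℓ' , e with toℕ-injective {i = ℓ} {j = ℓ'} (≡ᵇ⇒≡ _ _ ℓ≡ℓ') | innerEdge⇒neighbour p p' e
  ... | ≡.refl | 0F , ≡.refl = 0F , ≡.refl , ≡.refl
  ... | ≡.refl | 1F , ≡.refl = 1F , ≡.refl , ≡.refl
  ... | ≡.refl | 2F , ≡.refl = 2F , ≡.sym (innerSlot₂-unshifted p ℓ e) , ≡.refl
  adjacent⇒neighbour ℓ p ℓ' p' t | inj₂ links with Equivalence.to T-∨ links
  ... | inj₁ l with link⇒coordinates ℓ p ℓ' p' l
  ... | ≡.refl , ≡.refl , e = 2F , toℕ-injective (≡.trans (≡.sym e) (≡.sym (toℕ-next ℓ))) , ≡.refl
  adjacent⇒neighbour ℓ p ℓ' p' t | inj₂ links | inj₂ l with link⇒coordinates ℓ' p' ℓ p l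
  ... | ≡.refl , ≡.refl , e = 2F , nextBlock≡⇒≡prev ℓ' ℓ e , ≡.refl

  neighbour : Fin n → Fin 3 → Fin n
  neighbour i q = vertex (neighbourBlock (position i) q (block i)) (neighbourPosition (position i) q)

  neighbour-vertex : ∀ ℓ p q → neighbour (vertex ℓ p) q ≡ vertex (neighbourBlock p q ℓ) (neighbourPosition p q)
  neighbour-vertex ℓ p q = ≡.cong₂ (λ ℓ' p' → vertex (neighbourBlock p' q ℓ') (neighbourPosition p' q))
                                   (block-vertex ℓ p) (position-vertex ℓ p)

  G-neighbour : ∀ i q → G i (neighbour i q)
  G-neighbour i q = ≡.subst id (≡.sym (G-coordinates i (neighbour i q)))
    (≡.subst₂ (λ ℓ' p' → T (adjacent ℓ p ℓ' p')) (≡.sym (block-vertex ℓ' p')) (≡.sym (position-vertex ℓ' p'))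
      (neighbour-adjacent ℓ p q))
    where ℓ = block i
          p = position i
          ℓ' = neighbourBlock p q ℓ
          p' = neighbourPosition p q

  G⇒neighbour : ∀ {i j} → G i j → ∃[ q ] j ≡ neighbour i q
  G⇒neighbour {i} {j} Gij = neighbour-of-coordinates
    (adjacent⇒neighbour (block i) (position i) (block j) (position j) (≡.subst id (G-coordinates i j) Gij))
    where
    neighbour-of-coordinates : ∃[ q ] block j ≡ neighbourBlock (position i) q (block i)
                                    × position j ≡ neighbourPosition (position i) q →
                               ∃[ q ] j ≡ neighbour i q
    neighbour-of-coordinates (q , ℓ'≡ , p'≡) =
      q , ≡.trans (≡.sym (vertex-coordinates j)) (≡.cong₂ vertex ℓ'≡ p'≡)

  neighbour-injective : ∀ i {q q'} → neighbour i q ≡ neighbour i q' → q ≡ q'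
  neighbour-injective i {q} {q'} eq = neighbourPosition-injective (position i) q q'
    (≡.trans (≡.sym (position-vertex (neighbourBlock p q ℓ) (neighbourPosition p q)))
      (≡.trans (≡.cong position eq) (position-vertex (neighbourBlock p q' ℓ) (neighbourPosition p q'))))
    where ℓ = block i
          p = position i

  bdPosition? : ℕ → Bool
  bdPosition? r = (r ≡ᵇ 1) ∨ (r ≡ᵇ 3)

  bd? : ℕ → Bool
  bd? x = bdPosition? (x % 6)

  initial? : ℕ → Bool
  initial? x = bd? x ∨ ((x ≡ᵇ 0) ∨ (x ≡ᵇ 5))

  S : Subset n
  S = tabulate (initial? ∘ toℕ)

  initial⇒∈S : ∀ i → T (initial? (toℕ i)) → i ∈ S
  initial⇒∈S i t = lookup⇒[]= i S (≡.trans (lookup∘tabulate (initial? ∘ toℕ) i) (Equivalence.to T-≡ t))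

  bd⇒∈S : ∀ ℓ p → T (bdPosition? (toℕ p)) → vertex ℓ p ∈ S
  bd⇒∈S ℓ p t = initial⇒∈S (vertex ℓ p)
    (Equivalence.from T-∨ (inj₁ (≡.subst (T ∘ bdPosition?) (≡.sym (vertex%6≡position ℓ p)) t)))

  Forced : Fin n → Set
  Forced = Black G S

  force-neighbour : ∀ ℓ p q → Forced (vertex ℓ p) →
                    (∀ q' → q' ≢ q → Forced (vertex (neighbourBlock p q' ℓ) (neighbourPosition p q'))) →
                    Forced (vertex (neighbourBlock p q ℓ) (neighbourPosition p q))
  force-neighbour ℓ p q u-forced others-forced =
    ≡.subst Forced (neighbour-vertex ℓ p q)
      (force {v = neighbour (vertex ℓ p) q} (G-neighbour (vertex ℓ p) q) u-forced other-neighbours)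
    where
    other-neighbours : ∀ w → G (vertex ℓ p) w → w ≢ neighbour (vertex ℓ p) q → Forced w
    other-neighbours w Guw w≢ = forced-slot (G⇒neighbour {vertex ℓ p} {w} Guw)
      where
      forced-slot : ∃[ q' ] w ≡ neighbour (vertex ℓ p) q' → Forced w
      forced-slot (q' , w≡) = by-slot (q' ≟ᶠ q)
        where
        by-slot : Dec (q' ≡ q) → Forced w
        by-slot (yes q'≡q) = contradiction (≡.trans w≡ (≡.cong (neighbour (vertex ℓ p)) q'≡q)) w≢
        by-slot (no q'≢q)  = ≡.subst Forced (≡.sym (≡.trans w≡ (neighbour-vertex ℓ p q'))) (others-forced q' q'≢q)

  EndsForced : Fin k → Set
  EndsForced ℓ = Forced (vertex ℓ pa) × Forced (vertex ℓ pf)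

  block-forced : ∀ ℓ → EndsForced ℓ → ∀ p → Forced (vertex ℓ p)
  block-forced ℓ (a-forced , f-forced) = forced
    where
    b-forced = initial (bd⇒∈S ℓ pb tt)
    d-forced = initial (bd⇒∈S ℓ pd tt)
    forced : ∀ p → Forced (vertex ℓ p)
    forced pa = a-forced
    forced pb = b-forced
    forced pc = force-neighbour ℓ pd 1F d-forced λ where
      0F _   → b-forced
      1F 1≢1 → contradiction ≡.refl 1≢1
      2F _   → f-forced
    forced pd = d-forced
    forced pe = force-neighbour ℓ pb 2F b-forced λ where
      0F _   → a-forced
      1F _   → d-forced
      2F 2≢2 → contradiction ≡.refl 2≢2
    forced pf = f-forced

  next-inject₁ : ∀ (ℓ : Fin k₀) → next (inject₁ ℓ) ≡ suc ℓ
  next-inject₁ ℓ = toℕ-injective (≡.trans (toℕ-next (inject₁ ℓ)) (nextBlock-prev (suc ℓ)))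

  ends-forced-step : ∀ ℓ → EndsForced (inject₁ ℓ) → EndsForced (suc ℓ)
  ends-forced-step ℓ ends = a-forced , f-forced
    where
    previous : ∀ p → Forced (vertex (inject₁ ℓ) p)
    previous = block-forced (inject₁ ℓ) ends

    b-forced = initial (bd⇒∈S (suc ℓ) pb tt)
    d-forced = initial (bd⇒∈S (suc ℓ) pd tt)

    a-forced : Forced (vertex (suc ℓ) pa)
    a-forced = ≡.subst (λ ℓ' → Forced (vertex ℓ' pa)) (next-inject₁ ℓ)
      (force-neighbour (inject₁ ℓ) pf 2F (previous pf) λ where
        0F _   → previous pd
        1F _   → previous pe
        2F 2≢2 → contradiction ≡.refl 2≢2)

    c-forced : Forced (vertex (suc ℓ) pc)
    c-forced = force-neighbour (suc ℓ) pa 1F a-forced λ where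
      0F _   → b-forced
      1F 1≢1 → contradiction ≡.refl 1≢1
      2F _   → previous pf

    f-forced : Forced (vertex (suc ℓ) pf)
    f-forced = force-neighbour (suc ℓ) pd 2F d-forced λ where
      0F _   → b-forced
      1F _   → c-forced
      2F 2≢2 → contradiction ≡.refl 2≢2

  ends-forced : ∀ ℓ → EndsForced ℓ
  ends-forced = <-weakInduction EndsForced (initial (a₀f₀∈S pa tt) , initial (a₀f₀∈S pf tt)) ends-forced-step
    where
    a₀f₀∈S : ∀ p → T (initial? (toℕ p)) → vertex 0F p ∈ S
    a₀f₀∈S p = initial⇒∈S (vertex 0F p) ∘
               ≡.subst (T ∘ initial?) (≡.sym (≡.trans (toℕ-vertex 0F p) (ℕₚ.+-identityʳ (toℕ p))))

  S-forcing : IsZeroForcingSet G S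
  S-forcing v = ≡.subst Forced (vertex-coordinates v) (block-forced (block v) (ends-forced (block v)) (position v))

  bd?-periodic : ∀ x → bd? (6 + x) ≡ bd? x
  bd?-periodic x = ≡.cong bdPosition? (≡.trans (≡.cong (_% 6) (ℕₚ.+-comm 6 x)) ([m+n]%n≡m%n x 6))

  ∣S∣≡n/3+2 : ∣ S ∣ ≡ n / 3 + 2
  ∣S∣≡n/3+2 = begin
    ∣ S ∣                                            ≡⟨ ∣tabulate∣≡countBelow n initial? ⟩
    countBelow initial? (6 * k)                      ≡⟨ ≡.cong (countBelow initial?) (ℕₚ.*-comm 6 k) ⟩
    countBelow initial? (6 + k₀ * 6)                 ≡⟨ countBelow-+ 6 (k₀ * 6) initial? ⟩
    4 + countBelow (initial? ∘ (6 +_)) (k₀ * 6)      ≡⟨ ≡.cong (4 +_) (countBelow-cong (k₀ * 6) initial?-periodic) ⟩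
    4 + countBelow bd? (k₀ * 6)                      ≡⟨ ≡.cong (4 +_) (countBelow-periodic 6 bd? bd?-periodic k₀) ⟩
    4 + k₀ * 2                                       ≡⟨ 4+2k₀≡2k+2 k₀ ⟩
    2 * k + 2                                        ≡⟨ ≡.cong (_+ 2) (m*n/n≡m (2 * k) 3) ⟨
    2 * k * 3 / 3 + 2                                ≡⟨ ≡.cong (λ m → m / 3 + 2) (2k*3≡6k k) ⟩
    6 * k / 3 + 2                                    ∎
    where
    open ≡.≡-Reasoning
    initial?-periodic : ∀ x → initial? (6 + x) ≡ bd? x
    initial?-periodic x = ≡.trans (∨-identityʳ (bd? (6 + x))) (bd?-periodic x)
    4+2k₀≡2k+2 : ∀ k₀ → 4 + k₀ * 2 ≡ 2 * suc k₀ + 2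
    4+2k₀≡2k+2 = solve-∀
    2k*3≡6k : ∀ k → 2 * k * 3 ≡ 6 * k
    2k*3≡6k = solve-∀

  inner-twins : ∀ p → innerEdge? p pb ≡ innerEdge? p pc × innerEdge? p pd ≡ innerEdge? p pe
  inner-twins = from-yes (all? λ p →
    (innerEdge? p pb Bool.≟ innerEdge? p pc) ×-dec (innerEdge? p pd Bool.≟ innerEdge? p pe))

  twin-columns : ∀ {p₁ p₂} → (∀ ℓ' p' ℓ → adjacent ℓ' p' ℓ p₁ ≡ adjacent ℓ' p' ℓ p₂) →
                 ∀ (i : Fin n) ℓ → adjℕ k (toℕ i) (toℕ (vertex ℓ p₁)) ≡ adjℕ k (toℕ i) (toℕ (vertex ℓ p₂))
  twin-columns {p₁} {p₂} twins i ℓ = begin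
    adjℕ k (toℕ i) (toℕ (vertex ℓ p₁))
      ≡⟨ adjℕ-coordinates i (vertex ℓ p₁) ⟩
    adjacent (block i) (position i) (block (vertex ℓ p₁)) (position (vertex ℓ p₁))
      ≡⟨ ≡.cong₂ (adjacent (block i) (position i)) (block-vertex ℓ p₁) (position-vertex ℓ p₁) ⟩
    adjacent (block i) (position i) ℓ p₁
      ≡⟨ twins (block i) (position i) ℓ ⟩
    adjacent (block i) (position i) ℓ p₂
      ≡⟨ ≡.cong₂ (adjacent (block i) (position i)) (block-vertex ℓ p₂) (position-vertex ℓ p₂) ⟨
    adjacent (block i) (position i) (block (vertex ℓ p₂)) (position (vertex ℓ p₂))
      ≡⟨ adjℕ-coordinates i (vertex ℓ p₂) ⟨
    adjℕ k (toℕ i) (toℕ (vertex ℓ p₂))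
      ∎
    where open ≡.≡-Reasoning

  -- At positions b, …, e the link terms of adjacent reduce to false, leaving only the inner edge.
  bc-twins : ∀ (i : Fin n) ℓ → adjℕ k (toℕ i) (toℕ (vertex ℓ pb)) ≡ adjℕ k (toℕ i) (toℕ (vertex ℓ pc))
  bc-twins = twin-columns λ ℓ' p' ℓ →
    ≡.cong (λ e → ((toℕ ℓ' ≡ᵇ toℕ ℓ) ∧ e) ∨ (((toℕ p' ≡ᵇ 5) ∧ false) ∨ false)) (proj₁ (inner-twins p'))

  de-twins : ∀ (i : Fin n) ℓ → adjℕ k (toℕ i) (toℕ (vertex ℓ pd)) ≡ adjℕ k (toℕ i) (toℕ (vertex ℓ pe))
  de-twins = twin-columns λ ℓ' p' ℓ →
    ≡.cong (λ e → ((toℕ ℓ' ≡ᵇ toℕ ℓ) ∧ e) ∨ (((toℕ p' ≡ᵇ 5) ∧ false) ∨ false)) (proj₂ (inner-twins p'))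

  isNeighbourPosition? : Fin 6 → Fin 6 → Bool
  isNeighbourPosition? x p = does (any? λ q → x ≟ᶠ neighbourPosition p q)

  quotient-twins : ∀ p → isNeighbourPosition? pa p ≡ isNeighbourPosition? pe p ×
                         isNeighbourPosition? pf p ≡ isNeighbourPosition? pc p
  quotient-twins = from-yes (all? λ p →
    (isNeighbourPosition? pa p Bool.≟ isNeighbourPosition? pe p) ×-dec
    (isNeighbourPosition? pf p Bool.≟ isNeighbourPosition? pc p))

  data Pivot : Fin n → Set where
    pivot-a₀ : Pivot (vertex 0F pa)
    pivot-f₀ : Pivot (vertex 0F pf)
    pivot-b  : ∀ ℓ → Pivot (vertex ℓ pb)
    pivot-d  : ∀ ℓ → Pivot (vertex ℓ pd)

  ∈S⇒pivot : ∀ {v} → v ∈ S → Pivot v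
  ∈S⇒pivot {v} v∈S = by-residue (Equivalence.to T-∨ v-initial)
    where
    v-initial : T (initial? (toℕ v))
    v-initial = Equivalence.from T-≡ (≡.trans (≡.sym (lookup∘tabulate (initial? ∘ toℕ) v)) ([]=⇒lookup v∈S))

    at-position : ∀ p → toℕ v % 6 ≡ toℕ p → (∀ ℓ → Pivot (vertex ℓ p)) → Pivot v
    at-position p v%6≡p pivot = ≡.subst Pivot (≡.trans (≡.cong (vertex (block v)) (≡.sym position≡p))
                                                       (vertex-coordinates v))
                                  (pivot (block v))
      where position≡p = toℕ-injective (≡.trans (toℕ-position v) v%6≡p)

    at-vertex : ∀ p → toℕ v ≡ toℕ p → Pivot (vertex 0F p) → Pivot v
    at-vertex p v≡p = ≡.subst Pivot
      (toℕ-injective (≡.trans (≡.trans (toℕ-vertex 0F p) (ℕₚ.+-identityʳ (toℕ p))) (≡.sym v≡p)))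

    by-residue : T (bd? (toℕ v)) ⊎ T ((toℕ v ≡ᵇ 0) ∨ (toℕ v ≡ᵇ 5)) → Pivot v
    by-residue (inj₁ bd) with Equivalence.to T-∨ bd
    ... | inj₁ v≡b = at-position pb (≡ᵇ⇒≡ _ 1 v≡b) pivot-b
    ... | inj₂ v≡d = at-position pd (≡ᵇ⇒≡ _ 3 v≡d) pivot-d
    by-residue (inj₂ a₀f₀) with Equivalence.to T-∨ a₀f₀
    ... | inj₁ v≡a₀ = at-vertex pa (≡ᵇ⇒≡ _ 0 v≡a₀) pivot-a₀
    ... | inj₂ v≡f₀ = at-vertex pf (≡ᵇ⇒≡ _ 5 v≡f₀) pivot-f₀

  pivot-position≢ : ∀ {v} → Pivot v → position v ≢ pc × position v ≢ pe
  pivot-position≢ pivot-a₀    = ≡.subst (λ p → p ≢ pc × p ≢ pe) (≡.sym (position-vertex 0F pa)) ((λ ()) , (λ ()))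
  pivot-position≢ pivot-f₀    = ≡.subst (λ p → p ≢ pc × p ≢ pe) (≡.sym (position-vertex 0F pf)) ((λ ()) , (λ ()))
  pivot-position≢ (pivot-b ℓ) = ≡.subst (λ p → p ≢ pc × p ≢ pe) (≡.sym (position-vertex ℓ pb)) ((λ ()) , (λ ()))
  pivot-position≢ (pivot-d ℓ) = ≡.subst (λ p → p ≢ pc × p ≢ pe) (≡.sym (position-vertex ℓ pd)) ((λ ()) , (λ ()))

  pivot-at-a : ∀ {v} → Pivot v → position v ≡ pa → v ≡ vertex 0F pa
  pivot-at-a pivot-a₀    _  = ≡.refl
  pivot-at-a pivot-f₀    eq = contradiction (≡.trans (≡.sym (position-vertex 0F pf)) eq) λ ()
  pivot-at-a (pivot-b ℓ) eq = contradiction (≡.trans (≡.sym (position-vertex ℓ pb)) eq) λ ()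
  pivot-at-a (pivot-d ℓ) eq = contradiction (≡.trans (≡.sym (position-vertex ℓ pd)) eq) λ ()

  pivot-at-f : ∀ {v} → Pivot v → position v ≡ pf → v ≡ vertex 0F pf
  pivot-at-f pivot-a₀    eq = contradiction (≡.trans (≡.sym (position-vertex 0F pa)) eq) λ ()
  pivot-at-f pivot-f₀    _  = ≡.refl
  pivot-at-f (pivot-b ℓ) eq = contradiction (≡.trans (≡.sym (position-vertex ℓ pb)) eq) λ ()
  pivot-at-f (pivot-d ℓ) eq = contradiction (≡.trans (≡.sym (position-vertex ℓ pd)) eq) λ ()

module AdjacencyMatrix (k₀ : ℕ) {c ℓ ℓ' : Level} (R : RealField c ℓ ℓ') where

  open CubicGraph k₀
  open RealField R hiding (zero)
  open LinearAlgebra R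
  open import Algebra.Properties.Semiring.Sum semiring using (sum; sum-cong-≋; ∑-comm; *-distribʳ-sum)
  open import Relation.Binary.Reasoning.Setoid setoid

  A : Matrix R n
  A i j = indicator (adjℕ k (toℕ i) (toℕ j))

  indicator≉0⇔T : ∀ b → (¬ indicator b ≈ 0#) ⇔ T b
  indicator≉0⇔T true  = mk⇔ (λ _ → tt) (λ _ 1≈0 → 0≉1 (sym 1≈0))
  indicator≉0⇔T false = mk⇔ (λ 0≉0 → contradiction refl 0≉0) λ ()

  A∈S : InS R G A
  A∈S = (λ i j → reflexive (≡.cong indicator (adjℕ-sym i j))) ,
        (λ i j _ → indicator≉0⇔T (adjℕ k (toℕ i) (toℕ j)))
    where
    adjℕ-sym : ∀ i j → adjℕ k (toℕ i) (toℕ j) ≡ adjℕ k (toℕ j) (toℕ i)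
    adjℕ-sym i j = ≡.trans (adjℕ-coordinates i j)
      (≡.trans (adjacent-sym (block i) (position i) (block j) (position j)) (≡.sym (adjℕ-coordinates j i)))

  adjacency-row : ∀ i j → A i j ≈ sum (λ q → δ (neighbour i q) j)
  adjacency-row i j = by-adjacency (adjℕ k (toℕ i) (toℕ j)) ≡.refl
    where
    by-adjacency : ∀ b → adjℕ k (toℕ i) (toℕ j) ≡ b → A i j ≈ sum (λ q → δ (neighbour i q) j)
    by-adjacency true adj = at-neighbour (G⇒neighbour {i} {j} (≡.subst T (≡.sym adj) tt))
      where
      at-neighbour : ∃[ q ] j ≡ neighbour i q → A i j ≈ sum (λ q → δ (neighbour i q) j)
      at-neighbour (q , j≡) = begin
        A i j                             ≈⟨ reflexive (≡.cong indicator adj) ⟩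
        1#                                ≈⟨ ≡.subst (λ j → δ (neighbour i q) j ≈ 1#) (≡.sym j≡)
                                                      (δ-refl (neighbour i q)) ⟨
        δ (neighbour i q) j               ≈⟨ sum-single (λ q → δ (neighbour i q) j) q other-slots ⟨
        sum (λ q → δ (neighbour i q) j)   ∎
        where
        other-slots : ∀ q' → q' ≢ q → δ (neighbour i q') j ≈ 0#
        other-slots q' q'≢q = δ-≢ {i = neighbour i q'} {j = j} λ e → q'≢q (neighbour-injective i (≡.trans e j≡))
    by-adjacency false adj = trans (reflexive (≡.cong indicator adj)) (sym (sum-zero {f = λ q → δ (neighbour i q) j}
      λ q → δ-≢ {i = neighbour i q} {j = j} λ e → ≡.subst T adj (≡.subst (G i) e (G-neighbour i q))))

  row-sum : ∀ i y → sum (λ j → A i j * y j) ≈ sum (λ q → y (neighbour i q))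
  row-sum i y = begin
    sum (λ j → A i j * y j)
      ≈⟨ sum-cong-≋ (λ j → *-congʳ {y j} (adjacency-row i j)) ⟩
    sum (λ j → sum (λ q → δ (neighbour i q) j) * y j)
      ≈⟨ sum-cong-≋ (λ j → *-distribʳ-sum (y j) (λ q → δ (neighbour i q) j)) ⟩
    sum (λ j → sum (λ q → δ (neighbour i q) j * y j))
      ≈⟨ ∑-comm (λ j q → δ (neighbour i q) j * y j) ⟩
    sum (λ q → sum (λ j → δ (neighbour i q) j * y j))
      ≈⟨ sum-cong-≋ (λ q → sum-δ* y (neighbour i q)) ⟩
    sum (λ q → y (neighbour i q))
      ∎

  A-δ : ∀ i u → sum (λ j → A i j * δ u j) ≈ A i u
  A-δ i u = trans (sum-cong-≋ λ j → *-comm (A i j) (δ u j)) (sum-δ* (A i) u)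

  A-δ-position : ∀ i p → sum (λ j → A i j * δ p (position j)) ≈ indicator (isNeighbourPosition? p (position i))
  A-δ-position i p = begin
    sum (λ j → A i j * δ p (position j))
      ≈⟨ row-sum i (δ p ∘ position) ⟩
    sum (λ q → δ p (position (neighbour i q)))
      ≈⟨ sum-cong-≋ (λ q → reflexive (≡.cong (δ p) (position-neighbour q))) ⟩
    sum (λ q → δ p (neighbourPosition (position i) q))
      ≈⟨ sum-δ-injective (neighbourPosition (position i))
                         (λ {q} {q'} → neighbourPosition-injective (position i) q q') p ⟩
    indicator (isNeighbourPosition? p (position i))
      ∎
    where
    position-neighbour : ∀ q → position (neighbour i q) ≡ neighbourPosition (position i) q
    position-neighbour q =
      position-vertex (neighbourBlock (position i) q (block i)) (neighbourPosition (position i) q)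

  -- the null vector attached to the member of S at position p of block ℓ (no member sits at c or e)
  nullVectorAt : Fin k → Fin 6 → Fin n → Carrier
  nullVectorAt ℓ pa j = δ pa (position j) - δ pe (position j)
  nullVectorAt ℓ pf j = δ pf (position j) - δ pc (position j)
  nullVectorAt ℓ pb j = δ (vertex ℓ pb) j - δ (vertex ℓ pc) j
  nullVectorAt ℓ pd j = δ (vertex ℓ pd) j - δ (vertex ℓ pe) j
  nullVectorAt ℓ _  j = 0#

  nullVectorAt-in-kernel : ∀ ℓ p i → sum (λ j → A i j * nullVectorAt ℓ p j) ≈ 0#
  nullVectorAt-in-kernel ℓ pa = difference-in-kernel A (δ pa ∘ position) (δ pe ∘ position) λ i →
    trans (A-δ-position i pa) (trans (reflexive (≡.cong indicator (proj₁ (quotient-twins (position i)))))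
                                     (sym (A-δ-position i pe)))
  nullVectorAt-in-kernel ℓ pf = difference-in-kernel A (δ pf ∘ position) (δ pc ∘ position) λ i →
    trans (A-δ-position i pf) (trans (reflexive (≡.cong indicator (proj₂ (quotient-twins (position i)))))
                                     (sym (A-δ-position i pc)))
  nullVectorAt-in-kernel ℓ pb = difference-in-kernel A (δ (vertex ℓ pb)) (δ (vertex ℓ pc)) λ i →
    trans (A-δ i (vertex ℓ pb)) (trans (reflexive (≡.cong indicator (bc-twins i ℓ))) (sym (A-δ i (vertex ℓ pc))))
  nullVectorAt-in-kernel ℓ pd = difference-in-kernel A (δ (vertex ℓ pd)) (δ (vertex ℓ pe)) λ i →
    trans (A-δ i (vertex ℓ pd)) (trans (reflexive (≡.cong indicator (de-twins i ℓ))) (sym (A-δ i (vertex ℓ pe))))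
  nullVectorAt-in-kernel ℓ pc i = sum-zero λ j → zeroʳ (A i j)
  nullVectorAt-in-kernel ℓ pe i = sum-zero λ j → zeroʳ (A i j)

  nullVector : Fin n → Fin n → Carrier
  nullVector v = nullVectorAt (block v) (position v)

  nullVector-vertex : ∀ ℓ p v → nullVector (vertex ℓ p) v ≡ nullVectorAt ℓ p v
  nullVector-vertex ℓ p v = ≡.cong₂ (λ ℓ p → nullVectorAt ℓ p v) (block-vertex ℓ p) (position-vertex ℓ p)

  δ-position-≢ : ∀ {p} v → position v ≢ p → δ p (position v) ≈ 0#
  δ-position-≢ {p} v v↦̸p = δ-≢ {i = p} {j = position v} (v↦̸p ∘ ≡.sym)

  δ-vertex-≢ : ∀ ℓ p v → position v ≢ p → δ (vertex ℓ p) v ≈ 0#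
  δ-vertex-≢ ℓ p v v↦̸p = δ-≢ {i = vertex ℓ p} {j = v} λ u≡v →
    v↦̸p (≡.trans (≡.cong position (≡.sym u≡v)) (position-vertex ℓ p))

  δ-position : ∀ {v} u p → position u ≡ p → (position v ≡ p → v ≡ u) → δ p (position v) ≈ δ u v
  δ-position {v} u p u↦p v↦p⇒v≡u = by-position (position v ≟ᶠ p)
    where
    by-position : Dec (position v ≡ p) → δ p (position v) ≈ δ u v
    by-position (yes v↦p) = trans (≡.subst (λ x → δ p x ≈ 1#) (≡.sym v↦p) (δ-refl p))
                                  (sym (≡.subst (λ x → δ u x ≈ 1#) (≡.sym (v↦p⇒v≡u v↦p)) (δ-refl u)))
    by-position (no v↦̸p) = trans (δ-≢ {i = p} {j = position v} (v↦̸p ∘ ≡.sym))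
                                  (sym (δ-≢ {i = u} {j = v} λ u≡v →
                                    v↦̸p (≡.trans (≡.cong position (≡.sym u≡v)) u↦p)))

  nullVector-on-pivots : ∀ {v' v} → Pivot v' → Pivot v → nullVector v' v ≈ δ v' v
  nullVector-on-pivots {v = v} pivot-a₀ pv = begin
    nullVector (vertex 0F pa) v               ≡⟨ nullVector-vertex 0F pa v ⟩
    δ pa (position v) - δ pe (position v)     ≈⟨ x-y≈x (δ-position-≢ v (proj₂ (pivot-position≢ pv))) ⟩
    δ pa (position v)                         ≈⟨ δ-position (vertex 0F pa) pa (position-vertex 0F pa)
                                                                (pivot-at-a pv) ⟩
    δ (vertex 0F pa) v                        ∎
  nullVector-on-pivots {v = v} pivot-f₀ pv = begin
    nullVector (vertex 0F pf) v               ≡⟨ nullVector-vertex 0F pf v ⟩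
    δ pf (position v) - δ pc (position v)     ≈⟨ x-y≈x (δ-position-≢ v (proj₁ (pivot-position≢ pv))) ⟩
    δ pf (position v)                         ≈⟨ δ-position (vertex 0F pf) pf (position-vertex 0F pf)
                                                                (pivot-at-f pv) ⟩
    δ (vertex 0F pf) v                        ∎
  nullVector-on-pivots {v = v} (pivot-b ℓ) pv = begin
    nullVector (vertex ℓ pb) v                ≡⟨ nullVector-vertex ℓ pb v ⟩
    δ (vertex ℓ pb) v - δ (vertex ℓ pc) v     ≈⟨ x-y≈x (δ-vertex-≢ ℓ pc v (proj₁ (pivot-position≢ pv))) ⟩
    δ (vertex ℓ pb) v                         ∎
  nullVector-on-pivots {v = v} (pivot-d ℓ) pv = begin
    nullVector (vertex ℓ pd) v                ≡⟨ nullVector-vertex ℓ pd v ⟩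
    δ (vertex ℓ pd) v - δ (vertex ℓ pe) v     ≈⟨ x-y≈x (δ-vertex-≢ ℓ pe v (proj₂ (pivot-position≢ pv))) ⟩
    δ (vertex ℓ pd) v                         ∎

  nullVectors : Fin ∣ S ∣ → Fin n → Carrier
  nullVectors r = nullVector (elements S r)

  nullity≥∣S∣ : NullityAtLeast R A ∣ S ∣
  nullity≥∣S∣ = nullVectors , in-kernel , diagonal⇒independent nullVectors (elements S) diagonal off-diagonal
    where
    pivot : ∀ r → Pivot (elements S r)
    pivot r = ∈S⇒pivot (elements-∈ S r)

    in-kernel : ∀ r → InKernel R A (nullVectors r)
    in-kernel r i = ≡.subst (_≈ 0#) (≡.sym (Σ[<]≡sum n (λ j → A i j * nullVectors r j)))
                      (nullVectorAt-in-kernel (block (elements S r)) (position (elements S r)) i)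

    diagonal : ∀ r → ¬ nullVectors r (elements S r) ≈ 0#
    diagonal r v≈0 =
      0≉1 (trans (sym v≈0) (trans (nullVector-on-pivots (pivot r) (pivot r)) (δ-refl (elements S r))))

    off-diagonal : ∀ r r' → r' ≢ r → nullVectors r' (elements S r) ≈ 0#
    off-diagonal r r' r'≢r = trans (nullVector-on-pivots (pivot r') (pivot r))
                                   (δ-≢ {i = elements S r'} {j = elements S r} (r'≢r ∘ elements-injective S))

open import Data.Nat using (_≤_; _*_; _+_; _/_)

theorem12 : ∀ {c ℓ ℓ' : Level} (R : RealField c ℓ ℓ') (k : ℕ) → 1 ≤ k →
    IsZeroForcingNumber (cubicGraph k) ((6 * k) / 3 + 2) ×
    IsMaximumNullity R (cubicGraph k) ((6 * k) / 3 + 2)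
theorem12 R (suc k₀) _ =
  ≡.subst (λ m → IsZeroForcingNumber G m × IsMaximumNullity R G m) ∣S∣≡n/3+2
    (LinearAlgebra.zero-forcing-number≡maximum-nullity R S-forcing A∈S nullity≥∣S∣)
  where
  open CubicGraph k₀
  open AdjacencyMatrix k₀ R
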